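{- Let $\mathcal{D}_h$ be a complete abstraction of $\mathcal{D}_l$ relative to a refinement mapping $m$. Then for any ground high-level action sequence $\vec\alpha$ and any high-level situation-suppressed formula $\phi$: if $\mathcal{D}_l\cup\mathcal{C}\models\exists s.\,Do(m(\vec\alpha),S_0,s)\land m(\phi)[s]$, then $\mathcal{D}_h\models Executable(do(\vec\alpha,S_0))\land\phi[do(\vec\alpha,S_0)]$.
   Context: Situation calculus setting. Objects are a countably infinite set $\mathcal{N}$ of standard names (unique names and domain closure); no function symbols other than constants; no non-fluent predicates. Situations: $S_0$ and $do(a,s)$; $do([a_1,\dots,a_n],s)$ abbreviates $do(a_n,\dots,do(a_1,s)\dots)$, also written $do(\vec a,s)$. $Poss(a,s)$ means $a$ is executable in $s$; $Executable(s)$ means every action along the history from $S_0$ to $s$ was possible where performed. A basic action theory (BAT) over finitely many action types $\mathcal{A}$ and fluents $\mathcal{F}$ consists of initial-state axioms $\mathcal{D}_{S_0}$, precondition axioms $Poss(A(\vec x),s)\equiv\phi^{Poss}_A(\vec x,s)$, successor state axioms $F(\vec x,do(a,s))\equiv\phi^{ssa}_F(\vec x,a,s)$ (right-hand sides uniform in $s$), unique names/domain closure axioms for actions $\mathcal{D}_{ca}$ and for objects $\mathcal{D}_{coa}$, and foundational axioms $\Sigma$. A situation-suppressed formula omits situation arguments of fluents; $\phi[s]$ restores $s$. ConGolog programs $\delta::=\alpha\mid\varphi?\mid\delta_1;\delta_2\mid\delta_1|\delta_2\mid\pi x.\delta\mid\delta^*\mid\delta_1\|\delta_2$, $nil=True?$;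 $\mathcal{C}$ are the axioms: $Trans(\alpha,s,\delta',s')\equiv s'=do(\alpha,s)\land Poss(\alpha,s)\land\delta'=True?$; $Trans(\varphi?,s,\delta',s')\equiv False$; $Trans(\delta_1;\delta_2,s,\delta',s')\equiv\exists\delta_1'(Trans(\delta_1,s,\delta_1',s')\land\delta'=\delta_1';\delta_2)\lor(Final(\delta_1,s)\land Trans(\delta_2,s,\delta',s'))$; $Trans(\delta_1|\delta_2,\cdot)\equiv Trans(\delta_1,\cdot)\lor Trans(\delta_2,\cdot)$; $Trans(\pi x.\delta,s,\delta',s')\equiv\exists x.Trans(\delta,s,\delta',s')$; $Trans(\delta^*,s,\delta',s')\equiv\exists\delta''(Trans(\delta,s,\delta'',s')\land\delta'=\delta'';\delta^*)$; $Trans(\delta_1\|\delta_2,s,\delta',s')\equiv\exists\delta_1'(Trans(\delta_1,s,\delta_1',s')\land\delta'=\delta_1'\|\delta_2)\lor\exists\delta_2'(Trans(\delta_2,s,\delta_2',s')\land\delta'=\delta_1\|\delta_2')$; $Final(\alpha,s)\equiv False$; $Final(\varphi?,s)\equiv\varphi[s]$; $Final(\delta_1;\delta_2,s)\equiv Final(\delta_1,s)\land Final(\delta_2,s)$; $Final(\delta_1|\delta_2,s)\equiv Final(\delta_1,s)\lor Final(\delta_2,s)$; $Final(\pi x.\delta,s)\equiv\exists x.Final(\delta,s)$; $Final(\delta^*,s)\equiv True$; $Final(\delta_1\|\delta_2,s)\equiv Final(\delta_1,s)\land Final(\delta_2,s)$. $Do(\delta,s,s')\doteq\exists\delta'.Trans^*(\delta,s,\delta',s')\land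 Final(\delta',s')$, $Trans^*$ the reflexive transitive closure. $\mathcal{D}_h$ (high-level) and $\mathcal{D}_l$ (low-level) are BATs with action types $\mathcal{A}_h,\mathcal{A}_l$ and fluents $\mathcal{F}_h,\mathcal{F}_l$, sharing only $\mathcal{N}$. A refinement mapping $m$ maps each $A\in\mathcal{A}_h$ to a situation-determined ConGolog program $m(A(\vec x))$ over $\mathcal{D}_l$ with free variables $\vec x$, and each $F\in\mathcal{F}_h$ to a situation-suppressed low-level formula $m(F(\vec x))$; $m(\phi)$ substitutes $m(F(\vec x))$ for fluent atoms; $m(\alpha_1,\dots,\alpha_n)=m(\alpha_1);\dots;m(\alpha_n)$, $m(\epsilon)=nil$. For a model $M_h$ of $\mathcal{D}_h$ and a model $M_l$ of $\mathcal{D}_l\cup\mathcal{C}$: $s_h\simeq_m^{M_h,M_l}s_l$ iff for all $F\in\mathcal{F}_h$ and assignments $v$, $M_h,v[s/s_h]\models F(\vec x,s)$ iff $M_l,v[s/s_l]\models m(F(\vec x))[s]$. A relation $B$ between situation domains is an $m$-bisimulation if each $\langle s_h,s_l\rangle\in B$ satisfies: (1) $s_h\simeq_m^{M_h,M_l}s_l$; (2) for each $A\in\mathcal{A}_h$ and $v$, if some $s_h'$ has $M_h,v[s/s_h,s'/s_h']\models Poss(A(\vec x),s)\land s'=do(A(\vec x),s)$ then some $s_l'$ has $M_l,v[s/s_l,s'/s_l']\models Do(m(A(\vec x)),s,s')$ and $\langle s_h',s_l'\rangle\in B$; (3) conversely, if some $s_l'$ has $M_l,v[s/s_l,s'/s_l']\models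 Do(m(A(\vec x)),s,s')$ then some $s_h'$ has $M_h,v[s/s_h,s'/s_h']\models Poss(A(\vec x),s)\land s'=do(A(\vec x),s)$ and $\langle s_h',s_l'\rangle\in B$. $M_h\sim_m M_l$ iff some $m$-bisimulation contains $\langle S_0^{M_h},S_0^{M_l}\rangle$. $\mathcal{D}_h$ is a complete abstraction of $\mathcal{D}_l$ relative to $m$ iff for every model $M_h$ of $\mathcal{D}_h$ there is a model $M_l$ of $\mathcal{D}_l\cup\mathcal{C}$ with $M_h\sim_m M_l$. -}

module Defs where

open import Data.Nat using (ℕ; zero; suc; NonZero)
open import Data.Fin using (Fin; toℕ)
open import Data.Vec using (Vec; []; _∷_; map; tabulate)
open import Data.List using (List; []; _∷_)
open import Data.Product using (Σ; _×_; _,_)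
open import Data.Sum using (_⊎_)
open import Data.Empty using (⊥)
open import Data.Unit using (⊤)
open import Relation.Nullary using (¬_)
open import Relation.Binary.PropositionalEquality using (_≡_)

infixr 5 _∷ᶠ_ _++ᶠ_

_∷ᶠ_ : {A : Set} → A → (ℕ → A) → ℕ → A
(x ∷ᶠ f) zero = x
(x ∷ᶠ f) (suc i) = f i

_++ᶠ_ : {A : Set} {k : ℕ} → Vec A k → (ℕ → A) → ℕ → A
[] ++ᶠ f = f
(x ∷ xs) ++ᶠ f = x ∷ᶠ (xs ++ᶠ f)

firstK : {A : Set} (k : ℕ) → (ℕ → A) → Vec A k
firstK k f = tabulate (λ i → f (toℕ i))

_iff_ : Set → Set → Set
A iff B = (A → B) × (B → A)

-- Signatures: finitely many action types and fluents, with arities.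
-- Objects are the standard names ℕ (unique names + domain closure).

record Signature : Set where
  field
    nA  : ℕ
    -- the action sort is nonempty (standard first-order semantics)
    nA-nonzero : NonZero nA
    aAr : Fin nA → ℕ
    nF  : ℕ
    fAr : Fin nF → ℕ

module _ (S : Signature) where
  open Signature S

  -- Actions (unique names + domain closure for actions): A(n⃗)
  record Action : Set where
    constructor _⟨_⟩
    field
      typ  : Fin nA
      args : Vec ℕ (aAr typ)

  -- Situations (foundational axioms Σ): finite action histories,
  -- most recent action first; S0 = [].
  Sit : Set
  Sit = List Action

  -- Object terms and action terms; object variables and action variables
  -- are two separate sorts of de Bruijn indices.
  data OTerm : Set where
    var : ℕ → OTerm
    nm  : ℕ → OTerm

  data ATerm : Set where
    avar : ℕ → ATerm
    act  : (A : Fin nA) → Vec OTerm (aAr A) → ATerm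

  data Formula : Set where
    tt ff : Formula
    fl    : (F : Fin nF) → Vec OTerm (fAr F) → Formula
    _≐_   : OTerm → OTerm → Formula
    _≐ₐ_  : ATerm → ATerm → Formula
    ¬'_   : Formula → Formula
    _∧'_ _∨'_ _⇒'_ : Formula → Formula → Formula
    ∀o ∃o : Formula → Formula
    ∀a ∃a : Formula → Formula

  data Prog : Set where
    prim  : ATerm → Prog
    _¿    : Formula → Prog
    _⨾_   : Prog → Prog → Prog
    _∣ₚ_  : Prog → Prog → Prog
    π     : Prog → Prog
    _*    : Prog → Prog
    _∥_   : Prog → Prog → Prog

  record Structure : Set₁ where
    field
      Holds : (F : Fin nF) → Vec ℕ (fAr F) → Sit → Set
      Poss  : Action → Sit → Set

  record Val : Set where
    constructor val
    field
      ov : ℕ → ℕ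
      av : ℕ → Action

  -- Basic action theory.
  --  * Init: the set of initial-state axioms D_S0 (sentences about S0);
  --  * possAx A: φ^Poss_A, free object variables 0..aAr A - 1 are x⃗;
  --  * ssaAx F: φ^ssa_F, free object variables 0..fAr F - 1 are x⃗ and
  --    free action variable 0 is a.
  record BAT : Set₁ where
    field
      Init  : Formula → Set
      possAx : Fin nA → Formula
      ssaAx  : Fin nF → Formula

module _ {S : Signature} where
  open Signature S

  nil : Prog S
  nil = tt ¿

  S₀ : Sit S
  S₀ = []

  doₛ : Action S → Sit S → Sit S
  doₛ a s = a ∷ s

  doSeq : List (Action S) → Sit S → Sit S
  doSeq [] s = s
  doSeq (a ∷ as) s = doSeq as (doₛ a s)

  shiftO : OTerm S → OTerm S
  shiftO (var i) = var (suc i)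
  shiftO (nm n) = nm n

  liftσ : (ℕ → OTerm S) → ℕ → OTerm S
  liftσ σ = var 0 ∷ᶠ (λ i → shiftO (σ i))

  substO : (ℕ → OTerm S) → OTerm S → OTerm S
  substO σ (var i) = σ i
  substO σ (nm n) = nm n

  substOs : ∀ {k} → (ℕ → OTerm S) → Vec (OTerm S) k → Vec (OTerm S) k
  substOs σ [] = []
  substOs σ (t ∷ ts) = substO σ t ∷ substOs σ ts

  substA : (ℕ → OTerm S) → ATerm S → ATerm S
  substA σ (avar i) = avar i
  substA σ (act A ts) = act A (substOs σ ts)

  substF : (ℕ → OTerm S) → Formula S → Formula S
  substF σ tt = tt
  substF σ ff = ff
  substF σ (fl F ts) = fl F (substOs σ ts)
  substF σ (t ≐ u) = substO σ t ≐ substO σ u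
  substF σ (a ≐ₐ b) = substA σ a ≐ₐ substA σ b
  substF σ (¬' φ) = ¬' substF σ φ
  substF σ (φ ∧' ψ) = substF σ φ ∧' substF σ ψ
  substF σ (φ ∨' ψ) = substF σ φ ∨' substF σ ψ
  substF σ (φ ⇒' ψ) = substF σ φ ⇒' substF σ ψ
  substF σ (∀o φ) = ∀o (substF (liftσ σ) φ)
  substF σ (∃o φ) = ∃o (substF (liftσ σ) φ)
  substF σ (∀a φ) = ∀a (substF σ φ)
  substF σ (∃a φ) = ∃a (substF σ φ)

  substP : (ℕ → OTerm S) → Prog S → Prog S
  substP σ (prim a) = prim (substA σ a)
  substP σ (φ ¿) = substF σ φ ¿
  substP σ (δ ⨾ γ) = substP σ δ ⨾ substP σ γ
  substP σ (δ ∣ₚ γ) = substP σ δ ∣ₚ substP σ γ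
  substP σ (π δ) = π (substP (liftσ σ) δ)
  substP σ (δ *) = substP σ δ *
  substP σ (δ ∥ γ) = substP σ δ ∥ substP σ γ

  -- substitute names n⃗ for object variables 0..k-1 (the remaining free
  -- variables k, k+1, ... are renumbered to 0, 1, ...)
  instArgs : ∀ {k} → Vec ℕ k → ℕ → OTerm S
  instArgs ns = map nm ns ++ᶠ var

  evalO : Val S → OTerm S → ℕ
  evalO v (var i) = Val.ov v i
  evalO v (nm n) = n

  evalOs : ∀ {k} → Val S → Vec (OTerm S) k → Vec ℕ k
  evalOs v [] = []
  evalOs v (t ∷ ts) = evalO v t ∷ evalOs v ts

  evalA : Val S → ATerm S → Action S
  evalA v (avar i) = Val.av v i
  evalA v (act A ts) = A ⟨ evalOs v ts ⟩

  pushO : ℕ → Val S → Val S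
  pushO n (val o a) = val (n ∷ᶠ o) a

  pushA : Action S → Val S → Val S
  pushA x (val o a) = val o (x ∷ᶠ a)

  pushOs : ∀ {k} → Vec ℕ k → Val S → Val S
  pushOs ns (val o a) = val (ns ++ᶠ o) a

  Sat : Structure S → Val S → Sit S → Formula S → Set
  Sat M v s tt = ⊤
  Sat M v s ff = ⊥
  Sat M v s (fl F ts) = Structure.Holds M F (evalOs v ts) s
  Sat M v s (t ≐ u) = evalO v t ≡ evalO v u
  Sat M v s (a ≐ₐ b) = evalA v a ≡ evalA v b
  Sat M v s (¬' φ) = ¬ Sat M v s φ
  Sat M v s (φ ∧' ψ) = Sat M v s φ × Sat M v s ψ
  Sat M v s (φ ∨' ψ) = Sat M v s φ ⊎ Sat M v s ψ
  Sat M v s (φ ⇒' ψ) = Sat M v s φ → Sat M v s ψ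
  Sat M v s (∀o φ) = (n : ℕ) → Sat M (pushO n v) s φ
  Sat M v s (∃o φ) = Σ ℕ λ n → Sat M (pushO n v) s φ
  Sat M v s (∀a φ) = (x : Action S) → Sat M (pushA x v) s φ
  Sat M v s (∃a φ) = Σ (Action S) λ x → Sat M (pushA x v) s φ

  Executable : Structure S → Sit S → Set
  Executable M [] = ⊤
  Executable M (a ∷ s) = Executable M s × Structure.Poss M a s

  -- M is a model of the BAT D (together with Σ, D_ca, D_coa, which are
  -- built into the representation of objects, actions and situations)
  record IsModel (D : BAT S) (M : Structure S) : Set where
    open BAT D
    open Structure M
    field
      initAx : (φ : Formula S) → Init φ → (v : Val S) → Sat M v S₀ φ
      possAxs : (A : Fin nA) (ns : Vec ℕ (aAr A)) (s : Sit S) (v : Val S) →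
                Poss (A ⟨ ns ⟩) s iff Sat M (pushOs ns v) s (possAx A)
      ssaAxs : (F : Fin nF) (ns : Vec ℕ (fAr F)) (a : Action S) (s : Sit S) (v : Val S) →
               Holds F ns (doₛ a s) iff Sat M (pushOs ns (pushA a v)) s (ssaAx F)

  record Model (D : BAT S) : Set₁ where
    field
      str : Structure S
      isModel : IsModel D str

  -- ConGolog semantics (the axioms C): Final, Trans, Trans*, Do
  module _ (M : Structure S) (v : Val S) where
    open Structure M

    data Final : Prog S → Sit S → Set where
      fTest : ∀ {φ s} → Sat M v s φ → Final (φ ¿) s
      fSeq  : ∀ {δ₁ δ₂ s} → Final δ₁ s → Final δ₂ s → Final (δ₁ ⨾ δ₂) s
      fOr₁  : ∀ {δ₁ δ₂ s} → Final δ₁ s → Final (δ₁ ∣ₚ δ₂) s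
      fOr₂  : ∀ {δ₁ δ₂ s} → Final δ₂ s → Final (δ₁ ∣ₚ δ₂) s
      fPi   : ∀ {δ s} (n : ℕ) → Final (substP (nm n ∷ᶠ var) δ) s → Final (π δ) s
      fStar : ∀ {δ s} → Final (δ *) s
      fPar  : ∀ {δ₁ δ₂ s} → Final δ₁ s → Final δ₂ s → Final (δ₁ ∥ δ₂) s

    data Trans : Prog S → Sit S → Prog S → Sit S → Set where
      tPrim : ∀ {α s} → Poss (evalA v α) s →
              Trans (prim α) s nil (doₛ (evalA v α) s)
      tSeq₁ : ∀ {δ₁ δ₂ δ₁' s s'} → Trans δ₁ s δ₁' s' →
              Trans (δ₁ ⨾ δ₂) s (δ₁' ⨾ δ₂) s'
      tSeq₂ : ∀ {δ₁ δ₂ δ' s s'} → Final δ₁ s → Trans δ₂ s δ' s' →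
              Trans (δ₁ ⨾ δ₂) s δ' s'
      tOr₁  : ∀ {δ₁ δ₂ δ' s s'} → Trans δ₁ s δ' s' → Trans (δ₁ ∣ₚ δ₂) s δ' s'
      tOr₂  : ∀ {δ₁ δ₂ δ' s s'} → Trans δ₂ s δ' s' → Trans (δ₁ ∣ₚ δ₂) s δ' s'
      tPi   : ∀ {δ δ' s s'} (n : ℕ) → Trans (substP (nm n ∷ᶠ var) δ) s δ' s' →
              Trans (π δ) s δ' s'
      tStar : ∀ {δ δ'' s s'} → Trans δ s δ'' s' → Trans (δ *) s (δ'' ⨾ (δ *)) s'
      tPar₁ : ∀ {δ₁ δ₂ δ₁' s s'} → Trans δ₁ s δ₁' s' →
              Trans (δ₁ ∥ δ₂) s (δ₁' ∥ δ₂) s'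
      tPar₂ : ∀ {δ₁ δ₂ δ₂' s s'} → Trans δ₂ s δ₂' s' →
              Trans (δ₁ ∥ δ₂) s (δ₁ ∥ δ₂') s'

    data Trans* : Prog S → Sit S → Prog S → Sit S → Set where
      refl* : ∀ {δ s} → Trans* δ s δ s
      step* : ∀ {δ δ'' δ' s s'' s'} → Trans δ s δ'' s'' → Trans* δ'' s'' δ' s' →
              Trans* δ s δ' s'

    Do : Prog S → Sit S → Sit S → Set
    Do δ s s' = Σ (Prog S) λ δ' → Trans* δ s δ' s' × Final δ' s'

-- m(A(x⃗)) : a low-level program whose free object variables 0..aAr A - 1
-- are x⃗;  m(F(x⃗)) : a low-level formula whose free object variables
-- 0..fAr F - 1 are x⃗.
record Refinement (Sh Sl : Signature) : Set where
  field
    mA : Fin (Signature.nA Sh) → Prog Sl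
    mF : Fin (Signature.nF Sh) → Formula Sl

module _ {Sh Sl : Signature} (m : Refinement Sh Sl) where
  open Signature Sh
  open Refinement m

  -- High-level formulas to which m
  -- is applied contain no action terms (ActionFree below); the action
  -- cases are never used and are sent to ff.
  trO : OTerm Sh → OTerm Sl
  trO (var i) = var i
  trO (nm n) = nm n

  trOs : ∀ {k} → Vec (OTerm Sh) k → Vec (OTerm Sl) k
  trOs [] = []
  trOs (t ∷ ts) = trO t ∷ trOs ts

  mFormula : Formula Sh → Formula Sl
  mFormula tt = tt
  mFormula ff = ff
  mFormula (fl F ts) = substF (trOs ts ++ᶠ var) (mF F)
  mFormula (t ≐ u) = trO t ≐ trO u
  mFormula (a ≐ₐ b) = ff
  mFormula (¬' φ) = ¬' mFormula φ
  mFormula (φ ∧' ψ) = mFormula φ ∧' mFormula ψ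
  mFormula (φ ∨' ψ) = mFormula φ ∨' mFormula ψ
  mFormula (φ ⇒' ψ) = mFormula φ ⇒' mFormula ψ
  mFormula (∀o φ) = ∀o (mFormula φ)
  mFormula (∃o φ) = ∃o (mFormula φ)
  mFormula (∀a φ) = ff
  mFormula (∃a φ) = ff

  mAction : Action Sh → Prog Sl
  mAction (A ⟨ ns ⟩) = substP (instArgs ns) (mA A)

  mSeq : List (Action Sh) → Prog Sl
  mSeq [] = nil
  mSeq (α ∷ []) = mAction α
  mSeq (α ∷ αs@(_ ∷ _)) = mAction α ⨾ mSeq αs

  SituationDetermined : BAT Sl → Set₁
  SituationDetermined Dl =
    (Ml : Model Dl) (A : Fin nA) (ns : Vec ℕ (aAr A)) (v : Val Sl)
    (s s' : Sit Sl) (δ' δ'' : Prog Sl) →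
    Trans* (Model.str Ml) v (mAction (A ⟨ ns ⟩)) s δ' s' →
    Trans* (Model.str Ml) v (mAction (A ⟨ ns ⟩)) s δ'' s' →
    δ' ≡ δ''

  module _ (Mh : Structure Sh) (Ml : Structure Sl) where
    open Structure Mh using (Holds; Poss)

    _≃_ : Sit Sh → Sit Sl → Set
    sh ≃ sl = (F : Fin nF) (v : Val Sl) →
              Holds F (firstK (fAr F) (Val.ov v)) sh iff Sat Ml v sl (mF F)

    record IsBisimulation (B : Sit Sh → Sit Sl → Set) : Set₁ where
      field
        harmony : ∀ {sh sl} → B sh sl → sh ≃ sl
        forth   : ∀ {sh sl} → B sh sl → (A : Fin nA) (v : Val Sl) →
                  Poss (A ⟨ firstK (aAr A) (Val.ov v) ⟩) sh →
                  Σ (Sit Sl) λ sl' → Do Ml v (mA A) sl sl' ×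
                                     B (doₛ (A ⟨ firstK (aAr A) (Val.ov v) ⟩) sh) sl'
        back    : ∀ {sh sl} → B sh sl → (A : Fin nA) (v : Val Sl) (sl' : Sit Sl) →
                  Do Ml v (mA A) sl sl' →
                  Poss (A ⟨ firstK (aAr A) (Val.ov v) ⟩) sh ×
                  B (doₛ (A ⟨ firstK (aAr A) (Val.ov v) ⟩) sh) sl'

    Bisimilar : Set₁
    Bisimilar = Σ (Sit Sh → Sit Sl → Set) λ B → IsBisimulation B × B S₀ S₀

  CompleteAbstraction : BAT Sh → BAT Sl → Set₁
  CompleteAbstraction Dh Dl =
    (Mh : Model Dh) → Σ (Model Dl) λ Ml → Bisimilar (Model.str Mh) (Model.str Ml)

module _ {S : Signature} where
  ActionFree : Formula S → Set
  ActionFree tt = ⊤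
  ActionFree ff = ⊤
  ActionFree (fl F ts) = ⊤
  ActionFree (t ≐ u) = ⊤
  ActionFree (a ≐ₐ b) = ⊥
  ActionFree (¬' φ) = ActionFree φ
  ActionFree (φ ∧' ψ) = ActionFree φ × ActionFree ψ
  ActionFree (φ ∨' ψ) = ActionFree φ × ActionFree ψ
  ActionFree (φ ⇒' ψ) = ActionFree φ × ActionFree ψ
  ActionFree (∀o φ) = ActionFree φ
  ActionFree (∃o φ) = ActionFree φ
  ActionFree (∀a φ) = ⊥
  ActionFree (∃a φ) = ⊥

module Submission where

-- Completeness of the abstraction yields, for every high-level model, a
-- bisimilar low-level model.  In it the program m(α₁);…;m(αₙ) has an
-- execution from S₀ ending in a situation satisfying m(φ); splitting that
-- execution at the sequence boundaries and applying the "back" clause of the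
-- bisimulation once per action shows that each αᵢ is possible in the
-- corresponding high-level situation, and the final pair of situations is
-- again bisimilar, so by the harmony clause φ holds in do(α⃗, S₀).  The
-- bisimulation speaks of m(A(x⃗)) under an assignment, while the run executes
-- the ground instance m(A(n⃗)); a substitution lemma for Trans and Final
-- bridges the two.

open import Defs
open import Data.Nat using (ℕ; zero; suc; NonZero)
open import Data.Fin using (Fin)
open import Data.Vec using (Vec; []; _∷_; map; replicate)
open import Data.List using (List; []; _∷_)
open import Data.Product using (Σ; _×_; _,_; proj₁; proj₂)
open import Data.Sum using (_⊎_; inj₁; inj₂)
open import Data.Unit using (tt)
open import Relation.Nullary using (¬_)
open import Relation.Binary.PropositionalEquality
  using (_≡_; _≗_; refl; sym; trans; cong; cong₂; subst)

iff-refl : {A : Set} → A iff A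
iff-refl = (λ a → a) , (λ a → a)

iff-sym : {A B : Set} → A iff B → B iff A
iff-sym (f , g) = g , f

iff-trans : {A B C : Set} → A iff B → B iff C → A iff C
iff-trans (f , g) (h , k) = (λ a → h (f a)) , (λ c → g (k c))

¬-cong-iff : {A B : Set} → A iff B → (¬ A) iff (¬ B)
¬-cong-iff (f , g) = (λ ¬a b → ¬a (g b)) , (λ ¬b a → ¬b (f a))

×-cong-iff : {A B C D : Set} → A iff B → C iff D → (A × C) iff (B × D)
×-cong-iff (f , g) (h , k) = (λ (a , c) → f a , h c) , (λ (b , d) → g b , k d)

⊎-cong-iff : {A B C D : Set} → A iff B → C iff D → (A ⊎ C) iff (B ⊎ D)
⊎-cong-iff (f , g) (h , k) =
  (λ { (inj₁ a) → inj₁ (f a) ; (inj₂ c) → inj₂ (h c) }) ,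
  (λ { (inj₁ b) → inj₁ (g b) ; (inj₂ d) → inj₂ (k d) })

→-cong-iff : {A B C D : Set} → A iff B → C iff D → (A → C) iff (B → D)
→-cong-iff (f , g) (h , k) = (λ a→c b → h (a→c (g b))) , (λ b→d a → k (b→d (f a)))

Π-cong-iff : {X : Set} {A B : X → Set} →
             (∀ x → A x iff B x) → ((x : X) → A x) iff ((x : X) → B x)
Π-cong-iff e = (λ h x → proj₁ (e x) (h x)) , (λ h x → proj₂ (e x) (h x))

Σ-cong-iff : {X : Set} {A B : X → Set} → (∀ x → A x iff B x) → Σ X A iff Σ X B
Σ-cong-iff e = (λ (x , a) → x , proj₁ (e x) a) , (λ (x , b) → x , proj₂ (e x) b)

≡-cong-iff : {A : Set} {a b c d : A} → a ≡ c → b ≡ d → (a ≡ b) iff (c ≡ d)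
≡-cong-iff refl refl = iff-refl

firstK-++ᶠ : {A : Set} {k : ℕ} (xs : Vec A k) (f : ℕ → A) → firstK k (xs ++ᶠ f) ≡ xs
firstK-++ᶠ []       f = refl
firstK-++ᶠ (x ∷ xs) f = cong (x ∷_) (firstK-++ᶠ xs f)

module _ {S : Signature} where

  Subst : Set
  Subst = ℕ → OTerm S

  liftσ-cong : {σ τ : Subst} → σ ≗ τ → liftσ σ ≗ liftσ τ
  liftσ-cong e zero    = refl
  liftσ-cong e (suc i) = cong shiftO (e i)

  substO-cong : {σ τ : Subst} → σ ≗ τ → substO σ ≗ substO τ
  substO-cong e (var i) = e i
  substO-cong e (nm n)  = refl

  substOs-cong : {σ τ : Subst} {k : ℕ} → σ ≗ τ → substOs {k = k} σ ≗ substOs τ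
  substOs-cong e []       = refl
  substOs-cong e (t ∷ ts) = cong₂ _∷_ (substO-cong e t) (substOs-cong e ts)

  substA-cong : {σ τ : Subst} → σ ≗ τ → substA σ ≗ substA τ
  substA-cong e (avar i)   = refl
  substA-cong e (act A ts) = cong (act A) (substOs-cong e ts)

  substF-cong : {σ τ : Subst} → σ ≗ τ → substF σ ≗ substF τ
  substF-cong e tt        = refl
  substF-cong e ff        = refl
  substF-cong e (fl F ts) = cong (fl F) (substOs-cong e ts)
  substF-cong e (t ≐ u)   = cong₂ _≐_ (substO-cong e t) (substO-cong e u)
  substF-cong e (a ≐ₐ b)  = cong₂ _≐ₐ_ (substA-cong e a) (substA-cong e b)
  substF-cong e (¬' φ)    = cong ¬'_ (substF-cong e φ)
  substF-cong e (φ ∧' ψ)  = cong₂ _∧'_ (substF-cong e φ) (substF-cong e ψ)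
  substF-cong e (φ ∨' ψ)  = cong₂ _∨'_ (substF-cong e φ) (substF-cong e ψ)
  substF-cong e (φ ⇒' ψ)  = cong₂ _⇒'_ (substF-cong e φ) (substF-cong e ψ)
  substF-cong e (∀o φ)    = cong ∀o (substF-cong (liftσ-cong e) φ)
  substF-cong e (∃o φ)    = cong ∃o (substF-cong (liftσ-cong e) φ)
  substF-cong e (∀a φ)    = cong ∀a (substF-cong e φ)
  substF-cong e (∃a φ)    = cong ∃a (substF-cong e φ)

  substP-cong : {σ τ : Subst} → σ ≗ τ → substP σ ≗ substP τ
  substP-cong e (prim a) = cong prim (substA-cong e a)
  substP-cong e (φ ¿)    = cong _¿ (substF-cong e φ)
  substP-cong e (δ ⨾ γ)  = cong₂ _⨾_ (substP-cong e δ) (substP-cong e γ)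
  substP-cong e (δ ∣ₚ γ) = cong₂ _∣ₚ_ (substP-cong e δ) (substP-cong e γ)
  substP-cong e (π δ)    = cong π (substP-cong (liftσ-cong e) δ)
  substP-cong e (δ *)    = cong _* (substP-cong e δ)
  substP-cong e (δ ∥ γ)  = cong₂ _∥_ (substP-cong e δ) (substP-cong e γ)

  infixr 9 _∘ˢ_

  _∘ˢ_ : Subst → Subst → Subst
  (τ ∘ˢ σ) i = substO τ (σ i)

  liftσ-∘ˢ : (τ σ : Subst) → liftσ τ ∘ˢ liftσ σ ≗ liftσ (τ ∘ˢ σ)
  liftσ-∘ˢ τ σ zero = refl
  liftσ-∘ˢ τ σ (suc i) with σ i
  ... | var j = refl
  ... | nm n  = refl

  substO-∘ˢ : (τ σ : Subst) (t : OTerm S) → substO τ (substO σ t) ≡ substO (τ ∘ˢ σ) t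
  substO-∘ˢ τ σ (var i) = refl
  substO-∘ˢ τ σ (nm n)  = refl

  substOs-∘ˢ : (τ σ : Subst) {k : ℕ} (ts : Vec (OTerm S) k) →
               substOs τ (substOs σ ts) ≡ substOs (τ ∘ˢ σ) ts
  substOs-∘ˢ τ σ []       = refl
  substOs-∘ˢ τ σ (t ∷ ts) = cong₂ _∷_ (substO-∘ˢ τ σ t) (substOs-∘ˢ τ σ ts)

  substA-∘ˢ : (τ σ : Subst) (a : ATerm S) → substA τ (substA σ a) ≡ substA (τ ∘ˢ σ) a
  substA-∘ˢ τ σ (avar i)   = refl
  substA-∘ˢ τ σ (act A ts) = cong (act A) (substOs-∘ˢ τ σ ts)

  substF-∘ˢ : (τ σ : Subst) (φ : Formula S) → substF τ (substF σ φ) ≡ substF (τ ∘ˢ σ) φ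
  substF-∘ˢ τ σ tt        = refl
  substF-∘ˢ τ σ ff        = refl
  substF-∘ˢ τ σ (fl F ts) = cong (fl F) (substOs-∘ˢ τ σ ts)
  substF-∘ˢ τ σ (t ≐ u)   = cong₂ _≐_ (substO-∘ˢ τ σ t) (substO-∘ˢ τ σ u)
  substF-∘ˢ τ σ (a ≐ₐ b)  = cong₂ _≐ₐ_ (substA-∘ˢ τ σ a) (substA-∘ˢ τ σ b)
  substF-∘ˢ τ σ (¬' φ)    = cong ¬'_ (substF-∘ˢ τ σ φ)
  substF-∘ˢ τ σ (φ ∧' ψ)  = cong₂ _∧'_ (substF-∘ˢ τ σ φ) (substF-∘ˢ τ σ ψ)
  substF-∘ˢ τ σ (φ ∨' ψ)  = cong₂ _∨'_ (substF-∘ˢ τ σ φ) (substF-∘ˢ τ σ ψ)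
  substF-∘ˢ τ σ (φ ⇒' ψ)  = cong₂ _⇒'_ (substF-∘ˢ τ σ φ) (substF-∘ˢ τ σ ψ)
  substF-∘ˢ τ σ (∀o φ)    = cong ∀o (trans (substF-∘ˢ (liftσ τ) (liftσ σ) φ)
                                           (substF-cong (liftσ-∘ˢ τ σ) φ))
  substF-∘ˢ τ σ (∃o φ)    = cong ∃o (trans (substF-∘ˢ (liftσ τ) (liftσ σ) φ)
                                           (substF-cong (liftσ-∘ˢ τ σ) φ))
  substF-∘ˢ τ σ (∀a φ)    = cong ∀a (substF-∘ˢ τ σ φ)
  substF-∘ˢ τ σ (∃a φ)    = cong ∃a (substF-∘ˢ τ σ φ)

  substP-∘ˢ : (τ σ : Subst) (δ : Prog S) → substP τ (substP σ δ) ≡ substP (τ ∘ˢ σ) δ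
  substP-∘ˢ τ σ (prim a) = cong prim (substA-∘ˢ τ σ a)
  substP-∘ˢ τ σ (φ ¿)    = cong _¿ (substF-∘ˢ τ σ φ)
  substP-∘ˢ τ σ (δ ⨾ γ)  = cong₂ _⨾_ (substP-∘ˢ τ σ δ) (substP-∘ˢ τ σ γ)
  substP-∘ˢ τ σ (δ ∣ₚ γ) = cong₂ _∣ₚ_ (substP-∘ˢ τ σ δ) (substP-∘ˢ τ σ γ)
  substP-∘ˢ τ σ (π δ)    = cong π (trans (substP-∘ˢ (liftσ τ) (liftσ σ) δ)
                                         (substP-cong (liftσ-∘ˢ τ σ) δ))
  substP-∘ˢ τ σ (δ *)    = cong _* (substP-∘ˢ τ σ δ)
  substP-∘ˢ τ σ (δ ∥ γ)  = cong₂ _∥_ (substP-∘ˢ τ σ δ) (substP-∘ˢ τ σ γ)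

  inst₀ : ℕ → Subst
  inst₀ n = nm n ∷ᶠ var

  inst₀-∘ˢ-liftσ : (n : ℕ) (σ : Subst) → inst₀ n ∘ˢ liftσ σ ≗ σ ∘ˢ inst₀ n
  inst₀-∘ˢ-liftσ n σ zero = refl
  inst₀-∘ˢ-liftσ n σ (suc i) with σ i
  ... | var j = refl
  ... | nm k  = refl

  substP-inst₀-liftσ : (n : ℕ) (σ : Subst) (δ : Prog S) →
    substP (inst₀ n) (substP (liftσ σ) δ) ≡ substP σ (substP (inst₀ n) δ)
  substP-inst₀-liftσ n σ δ =
    trans (substP-∘ˢ (inst₀ n) (liftσ σ) δ)
          (trans (substP-cong (inst₀-∘ˢ-liftσ n σ) δ) (sym (substP-∘ˢ σ (inst₀ n) δ)))

  record Agree (σ : Subst) (v w : Val S) : Set where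
    field
      objects : (i : ℕ) → evalO v (σ i) ≡ Val.ov w i
      actions : (i : ℕ) → Val.av v i ≡ Val.av w i
  open Agree

  evalO-substO : {σ : Subst} {v w : Val S} → Agree σ v w →
                 (t : OTerm S) → evalO v (substO σ t) ≡ evalO w t
  evalO-substO r (var i) = objects r i
  evalO-substO r (nm n)  = refl

  evalOs-substOs : {σ : Subst} {v w : Val S} {k : ℕ} → Agree σ v w →
                   (ts : Vec (OTerm S) k) → evalOs v (substOs σ ts) ≡ evalOs w ts
  evalOs-substOs r []       = refl
  evalOs-substOs r (t ∷ ts) = cong₂ _∷_ (evalO-substO r t) (evalOs-substOs r ts)

  evalA-substA : {σ : Subst} {v w : Val S} → Agree σ v w →
                 (a : ATerm S) → evalA v (substA σ a) ≡ evalA w a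
  evalA-substA r (avar i)   = actions r i
  evalA-substA r (act A ts) = cong (A ⟨_⟩) (evalOs-substOs r ts)

  Agree-pushO : {σ : Subst} {v w : Val S} (n : ℕ) →
                Agree σ v w → Agree (liftσ σ) (pushO n v) (pushO n w)
  Agree-pushO {σ} {val o a} {w} n r = record { objects = lifted ; actions = actions r }
    where
    lifted : (i : ℕ) → evalO (pushO n (val o a)) (liftσ σ i) ≡ Val.ov (pushO n w) i
    lifted zero = refl
    lifted (suc i) with σ i | objects r i
    ... | var j | e = e
    ... | nm k  | e = e

  Agree-pushA : {σ : Subst} {v w : Val S} (x : Action S) →
                Agree σ v w → Agree σ (pushA x v) (pushA x w)
  Agree-pushA {σ} {val o a} {w} x r = record { objects = unchanged ; actions = pushed }
    where
    unchanged : (i : ℕ) → evalO (pushA x (val o a)) (σ i) ≡ Val.ov (pushA x w) i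
    unchanged i with σ i | objects r i
    ... | var j | e = e
    ... | nm k  | e = e
    pushed : (i : ℕ) → Val.av (pushA x (val o a)) i ≡ Val.av (pushA x w) i
    pushed zero    = refl
    pushed (suc i) = actions r i

  Agree-++ᶠ : {k : ℕ} (v : Val S) (ts : Vec (OTerm S) k) →
              Agree (ts ++ᶠ var) v (val (evalOs v ts ++ᶠ Val.ov v) (Val.av v))
  Agree-++ᶠ v ts = record { objects = prefix ts ; actions = λ _ → refl }
    where
    prefix : {k : ℕ} (ts : Vec (OTerm S) k) (i : ℕ) →
             evalO v ((ts ++ᶠ var) i) ≡ (evalOs v ts ++ᶠ Val.ov v) i
    prefix []       i       = refl
    prefix (t ∷ ts) zero    = refl
    prefix (t ∷ ts) (suc i) = prefix ts i

  evalOs-map-nm : {k : ℕ} (v : Val S) (ns : Vec ℕ k) → evalOs v (map nm ns) ≡ ns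
  evalOs-map-nm v []       = refl
  evalOs-map-nm v (n ∷ ns) = cong (n ∷_) (evalOs-map-nm v ns)

  Sat-substF : {M : Structure S} {s : Sit S} {σ : Subst} {v w : Val S} →
               Agree σ v w → (φ : Formula S) → Sat M v s (substF σ φ) iff Sat M w s φ
  Sat-substF r tt        = iff-refl
  Sat-substF r ff        = iff-refl
  Sat-substF {M} {s} r (fl F ts) =
    subst (λ ns → Structure.Holds M F ns s iff Structure.Holds M F (evalOs _ ts) s)
          (sym (evalOs-substOs r ts)) iff-refl
  Sat-substF r (t ≐ u)   = ≡-cong-iff (evalO-substO r t) (evalO-substO r u)
  Sat-substF r (a ≐ₐ b)  = ≡-cong-iff (evalA-substA r a) (evalA-substA r b)
  Sat-substF r (¬' φ)    = ¬-cong-iff (Sat-substF r φ)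
  Sat-substF r (φ ∧' ψ)  = ×-cong-iff (Sat-substF r φ) (Sat-substF r ψ)
  Sat-substF r (φ ∨' ψ)  = ⊎-cong-iff (Sat-substF r φ) (Sat-substF r ψ)
  Sat-substF r (φ ⇒' ψ)  = →-cong-iff (Sat-substF r φ) (Sat-substF r ψ)
  Sat-substF r (∀o φ)    = Π-cong-iff (λ n → Sat-substF (Agree-pushO n r) φ)
  Sat-substF r (∃o φ)    = Σ-cong-iff (λ n → Sat-substF (Agree-pushO n r) φ)
  Sat-substF r (∀a φ)    = Π-cong-iff (λ x → Sat-substF (Agree-pushA x r) φ)
  Sat-substF r (∃a φ)    = Σ-cong-iff (λ x → Sat-substF (Agree-pushA x r) φ)

  -- The program is indexed by an equation rather than by substP σ δ itself,
  -- so that the π case can be re-expressed via substP-inst₀-liftσ.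
  module _ {M : Structure S} {σ : Subst} {v w : Val S} (r : Agree σ v w) where

    Final-substP : {s : Sit S} (δσ δ : Prog S) → δσ ≡ substP σ δ →
                   Final M v δσ s → Final M w δ s
    Final-substP _ (φ ¿)    refl (fTest x)   = fTest (proj₁ (Sat-substF r φ) x)
    Final-substP _ (δ ⨾ γ)  refl (fSeq f g)  =
      fSeq (Final-substP _ δ refl f) (Final-substP _ γ refl g)
    Final-substP _ (δ ∣ₚ γ) refl (fOr₁ f)    = fOr₁ (Final-substP _ δ refl f)
    Final-substP _ (δ ∣ₚ γ) refl (fOr₂ g)    = fOr₂ (Final-substP _ γ refl g)
    Final-substP _ (π δ)    refl (fPi n f)   =
      fPi n (Final-substP _ (substP (inst₀ n) δ) (substP-inst₀-liftσ n σ δ) f)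
    Final-substP _ (δ *)    refl fStar       = fStar
    Final-substP _ (δ ∥ γ)  refl (fPar f g)  =
      fPar (Final-substP _ δ refl f) (Final-substP _ γ refl g)

    Trans-substP : {s s' : Sit S} {δ' : Prog S} (δσ δ : Prog S) → δσ ≡ substP σ δ →
                   Trans M v δσ s δ' s' →
                   Σ (Prog S) λ δ₀ → δ' ≡ substP σ δ₀ × Trans M w δ s δ₀ s'
    Trans-substP _ (prim a) refl (tPrim p) rewrite evalA-substA r a = nil , refl , tPrim p
    Trans-substP _ (δ ⨾ γ) refl (tSeq₁ t) with Trans-substP _ δ refl t
    ... | δ₀ , refl , t₀ = δ₀ ⨾ γ , refl , tSeq₁ t₀
    Trans-substP _ (δ ⨾ γ) refl (tSeq₂ f t) with Trans-substP _ γ refl t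
    ... | δ₀ , refl , t₀ = δ₀ , refl , tSeq₂ (Final-substP _ δ refl f) t₀
    Trans-substP _ (δ ∣ₚ γ) refl (tOr₁ t) with Trans-substP _ δ refl t
    ... | δ₀ , refl , t₀ = δ₀ , refl , tOr₁ t₀
    Trans-substP _ (δ ∣ₚ γ) refl (tOr₂ t) with Trans-substP _ γ refl t
    ... | δ₀ , refl , t₀ = δ₀ , refl , tOr₂ t₀
    Trans-substP _ (π δ) refl (tPi n t)
      with Trans-substP _ (substP (inst₀ n) δ) (substP-inst₀-liftσ n σ δ) t
    ... | δ₀ , refl , t₀ = δ₀ , refl , tPi n t₀
    Trans-substP _ (δ *) refl (tStar t) with Trans-substP _ δ refl t
    ... | δ₀ , refl , t₀ = δ₀ ⨾ (δ *) , refl , tStar t₀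
    Trans-substP _ (δ ∥ γ) refl (tPar₁ t) with Trans-substP _ δ refl t
    ... | δ₀ , refl , t₀ = δ₀ ∥ γ , refl , tPar₁ t₀
    Trans-substP _ (δ ∥ γ) refl (tPar₂ t) with Trans-substP _ γ refl t
    ... | δ₀ , refl , t₀ = δ ∥ δ₀ , refl , tPar₂ t₀

    Trans*-substP : {s s' : Sit S} {δ' : Prog S} (δσ δ : Prog S) → δσ ≡ substP σ δ →
                    Trans* M v δσ s δ' s' →
                    Σ (Prog S) λ δ₀ → δ' ≡ substP σ δ₀ × Trans* M w δ s δ₀ s'
    Trans*-substP _ δ e refl* = δ , e , refl*
    Trans*-substP _ δ e (step* t ts) with Trans-substP _ δ e t
    ... | δ₁ , e₁ , t₀ with Trans*-substP _ δ₁ e₁ ts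
    ... | δ₀ , e₀ , ts₀ = δ₀ , e₀ , step* t₀ ts₀

    Do-substP : {s s' : Sit S} (δ : Prog S) → Do M v (substP σ δ) s s' → Do M w δ s s'
    Do-substP δ (δ' , ts , f) with Trans*-substP _ δ refl ts
    ... | δ₀ , e , ts₀ = δ₀ , ts₀ , Final-substP δ' δ₀ e f

  Do-⨾⁻ : {M : Structure S} {v : Val S} {δ₁ δ₂ δ' : Prog S} {s s' : Sit S} →
          Trans* M v (δ₁ ⨾ δ₂) s δ' s' → Final M v δ' s' →
          Σ (Sit S) λ s₁ → Do M v δ₁ s s₁ × Do M v δ₂ s₁ s'
  Do-⨾⁻ refl* (fSeq f₁ f₂) = _ , (_ , refl* , f₁) , (_ , refl* , f₂)
  Do-⨾⁻ (step* (tSeq₁ t) ts) f with Do-⨾⁻ ts f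
  ... | s₁ , (δ₁' , ts₁ , f₁) , d₂ = s₁ , (δ₁' , step* t ts₁ , f₁) , d₂
  Do-⨾⁻ (step* (tSeq₂ f₁ t) ts) f = _ , (_ , refl* , f₁) , (_ , step* t ts , f)

module Bisimulation {Sh Sl : Signature} (m : Refinement Sh Sl)
                    {Mh : Structure Sh} {Ml : Structure Sl}
                    {B : Sit Sh → Sit Sl → Set} (isB : IsBisimulation m Mh Ml B) where
  open Refinement m
  open IsBisimulation isB

  back-mAction : {sh : Sit Sh} {sl sl' : Sit Sl} (α : Action Sh) (v : Val Sl) →
                 B sh sl → Do Ml v (mAction m α) sl sl' →
                 Structure.Poss Mh α sh × B (doₛ α sh) sl'
  back-mAction {sh} {sl' = sl'} (A ⟨ ns ⟩) v b d =
    subst (λ xs → Structure.Poss Mh (A ⟨ xs ⟩) sh × B (doₛ (A ⟨ xs ⟩) sh) sl')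
          (trans (firstK-++ᶠ (evalOs v (map nm ns)) (Val.ov v)) (evalOs-map-nm v ns))
          (back b A v' sl' (Do-substP (Agree-++ᶠ v (map nm ns)) (mA A) d))
    where
    v' : Val Sl
    v' = val (evalOs v (map nm ns) ++ᶠ Val.ov v) (Val.av v)

  back-mSeq : (αs : List (Action Sh)) (v : Val Sl) {sh : Sit Sh} {sl sl' : Sit Sl} →
              Executable Mh sh → B sh sl → Do Ml v (mSeq m αs) sl sl' →
              Executable Mh (doSeq αs sh) × B (doSeq αs sh) sl'
  back-mSeq [] v ex b (_ , refl* , _) = ex , b
  back-mSeq (α ∷ []) v ex b d =
    let (p , b') = back-mAction α v b d in (ex , p) , b'
  back-mSeq (α ∷ αs@(_ ∷ _)) v ex b (_ , ts , f) =
    let (sl₁ , d₁ , d₂) = Do-⨾⁻ ts f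
        (p , b₁)        = back-mAction α v b d₁
    in back-mSeq αs v (ex , p) b₁ d₂

  module _ {sh : Sit Sh} {sl : Sit Sl} (h : _≃_ m Mh Ml sh sl)
           (ah : ℕ → Action Sh) (al : ℕ → Action Sl) where

    evalOs-trOs : {k : ℕ} (o : ℕ → ℕ) (ts : Vec (OTerm Sh) k) →
                  evalOs (val o al) (trOs m ts) ≡ evalOs (val o ah) ts
    evalOs-trOs o []           = refl
    evalOs-trOs o (var i ∷ ts) = cong (o i ∷_) (evalOs-trOs o ts)
    evalOs-trOs o (nm n ∷ ts)  = cong (n ∷_) (evalOs-trOs o ts)

    Sat-mFormula : (φ : Formula Sh) → ActionFree φ → (o : ℕ → ℕ) →
                   Sat Mh (val o ah) sh φ iff Sat Ml (val o al) sl (mFormula m φ)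
    Sat-mFormula tt        _ o = iff-refl
    Sat-mFormula ff        _ o = iff-refl
    Sat-mFormula (fl F ts) _ o =
      iff-trans (subst (λ ns → Holds F (evalOs (val o ah) ts) sh iff Holds F ns sh)
                       (sym (trans (firstK-++ᶠ argsₗ o) (evalOs-trOs o ts)))
                       iff-refl)
        (iff-trans (h F (val (argsₗ ++ᶠ o) al))
                   (iff-sym (Sat-substF (Agree-++ᶠ (val o al) (trOs m ts)) (mF F))))
      where
      open Structure Mh using (Holds)
      argsₗ = evalOs (val o al) (trOs m ts)
    Sat-mFormula (var i ≐ var j) _ o = iff-refl
    Sat-mFormula (var i ≐ nm n)  _ o = iff-refl
    Sat-mFormula (nm n ≐ var j)  _ o = iff-refl
    Sat-mFormula (nm n ≐ nm k)   _ o = iff-refl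
    Sat-mFormula (¬' φ)   af        o = ¬-cong-iff (Sat-mFormula φ af o)
    Sat-mFormula (φ ∧' ψ) (aφ , aψ) o = ×-cong-iff (Sat-mFormula φ aφ o) (Sat-mFormula ψ aψ o)
    Sat-mFormula (φ ∨' ψ) (aφ , aψ) o = ⊎-cong-iff (Sat-mFormula φ aφ o) (Sat-mFormula ψ aψ o)
    Sat-mFormula (φ ⇒' ψ) (aφ , aψ) o = →-cong-iff (Sat-mFormula φ aφ o) (Sat-mFormula ψ aψ o)
    Sat-mFormula (∀o φ)   af        o = Π-cong-iff (λ n → Sat-mFormula φ af (n ∷ᶠ o))
    Sat-mFormula (∃o φ)   af        o = Σ-cong-iff (λ n → Sat-mFormula φ af (n ∷ᶠ o))

someAction : (S : Signature) → Action S
someAction S = inhabitant (Signature.nA S) (Signature.nA-nonzero S) ⟨ replicate _ 0 ⟩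
  where
  inhabitant : (n : ℕ) → NonZero n → Fin n
  inhabitant (suc n) _ = Fin.zero

theorem5 : (Sh Sl : Signature) (Dh : BAT Sh) (Dl : BAT Sl) (m : Refinement Sh Sl) →
    SituationDetermined m Dl →
    CompleteAbstraction m Dh Dl →
    (αs : List (Action Sh)) (φ : Formula Sh) → ActionFree φ →
    ((Ml : Model Dl) (v : Val Sl) →
      Σ (Sit Sl) λ s → Do (Model.str Ml) v (mSeq m αs) S₀ s ×
                       Sat (Model.str Ml) v s (mFormula m φ)) →
    (Mh : Model Dh) (v : Val Sh) →
      Executable (Model.str Mh) (doSeq αs S₀) ×
      Sat (Model.str Mh) v (doSeq αs S₀) φ
theorem5 Sh Sl Dh Dl m _ complete αs φ af lowRun Mh (val o ah) =
  let (Ml , B , isB , b₀) = complete Mh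
      vl                  = val o (λ _ → someAction Sl)
      (sl , run , satφ)   = lowRun Ml vl
      (ex , b)            = back-mSeq isB αs vl tt b₀ run
  in ex , proj₂ (Sat-mFormula isB (IsBisimulation.harmony isB b) ah (Val.av vl) φ af o) satφ
  where
  open Bisimulation m
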